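{- Let $P$ be a program and let $B$, $U$ be sets of pattern rules. If $B\cup U$ is correct w.r.t. $P$, then $T^\pi_{P,B}(U)$ is correct w.r.t. $P$.
   Context: Fix a signature $\Sigma$, a special constant $\mathsf{e}$ (also denoting the empty sequence) and an infinite countable set $X$ of variables, pairwise disjoint. $T(\Sigma,X)$ is the set of terms, $S(\Sigma,X)$ the set of substitutions; composition $x(\sigma\theta)=(x\sigma)\theta$, $\emptyset$ identity, $\sigma^0=\emptyset$, $\sigma^{n+1}=\sigma^n\sigma$, $\mathsf{e}\theta=\mathsf{e}$; $\sigma$ commutes with $\theta$ if $x\sigma\theta=x\theta\sigma$ for all $x$. Renamings are substitutions bijective on $X$; $\mathit{mgu}$ denotes most general unifiers (componentwise on sequences); $\mathit{Var}(\sigma)$ is the set of variables of the domain and of the images of the domain. A program is a set of rules $(u,\bar v)$, $\bar v$ a finite sequence $\langle\dots\rangle$ of terms; binary rules are written $(u,v)$, $v\in T(\Sigma,X)\cup\{\mathsf{e}\}$. $[r]$ is the set of renamings of a rule, $[U]=\bigcup_{r\in U}[r]$; $\bar r\ll_S U$ means a sequence of elements of $U$ variable disjoint from $S$ and from each other. $\mathit{id}$ is the set of rules $(\mathsf{f}(x_1..x_m),\mathsf{f}(x_1..x_m))$ with $x_i$ distinct. $T_P^\beta(U)=[\{(u,\mathsf{e})\in P\}]\cup[\{(u\theta,v\theta)\mid r=(u,\langle v_1..v_m\rangle)\in P,\ 1\le i\le m,\ \langle(u_1,\mathsf{e}),\dots,(u_{i-1},\mathsf{e}),(u_i,v)\rangle\ll_r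 U\cup\mathit{id},\ v\ne\mathsf{e}\text{ if }i<m,\ \theta\in\mathit{mgu}(\langle u_1..u_i\rangle,\langle v_1..v_i\rangle)\}]$; $\mathit{binunf}(P)=\bigcup_n(T_P^\beta)^n(\emptyset)$. A pattern substitution is $(\sigma,\mu)$ with $(\sigma,\mu)(n)=\sigma^n\mu$; a pattern term is $p=(s,(\sigma,\mu))$, $s\in T(\Sigma,X)\cup\{\mathsf{e}\}$, $p(n)=s\sigma^n\mu$, $\mathit{Var}(p)=\mathit{Var}(s)\cup\mathit{Var}(\sigma)\cup\mathit{Var}(\mu)$; $\widehat{s}=(s,(\emptyset,\emptyset))$. A pattern rule $r=(p,q)$ has $\mathit{Var}(r)=\mathit{Var}(p)\cup\mathit{Var}(q)$ and $\mathit{rules}(r)=\{(p(n),q(n))\mid n\in\mathbb N\}$; it is correct w.r.t. $P$ if $\mathit{rules}(r)\subseteq\mathit{binunf}(P)$ (a set is correct if all its elements are). A pattern substitution is an mgu of two equal-length sequences of pattern terms if its $n$-th instance is an mgu of the sequences of $n$-th instances for all $n$. $[r]=\{r'\mid\mathit{rules}(r')\subseteq[\mathit{rules}(r)]\}$ for pattern rules and $[U]=\bigcup_{r\in U}[r]$; $\ll_r$ extends to pattern rules via these variable sets. $\mathit{patid}=\{(\widehat{\mathsf{f}(x_1..x_m)},\widehat{\mathsf{f}(x_1..x_m)})\}$. $T^\pi_{P,B}(U)=[B]\cup[\{((u,(\sigma,\mu)),(v,(\sigma_i\sigma,\mu_i\mu)))\mid r=(u,\langle v_1..v_m\rangle)\in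 P,\ 1\le i\le m,\ \langle(p_1,\widehat{\mathsf{e}}),\dots,(p_{i-1},\widehat{\mathsf{e}}),(p_i,(v,(\sigma_i,\mu_i)))\rangle\ll_r U\cup\mathit{patid},\ v\ne\mathsf{e}\text{ if }i<m,\ (\sigma,\mu)\text{ an mgu of }\langle p_1..p_i\rangle\text{ and }\langle\widehat{v_1}..\widehat{v_i}\rangle,\ \sigma\text{ commutes with }\sigma_i\text{ and }\mu_i\}]$. -}

module Defs where

open import Data.Nat using (ℕ; zero; suc; _≤_; _<_; _⊔_)
open import Data.Nat.Properties using (≤-trans; m≤m⊔n; m≤n⊔m)
open import Data.Vec using (Vec; []; _∷_)
import Data.Vec as V
open import Data.List using (List; []; _∷_; _++_; map; take; length)
open import Data.List.Relation.Unary.All using (All)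
open import Data.List.Relation.Unary.AllPairs using (AllPairs)
import Data.List.Relation.Unary.Any
import Data.Vec.Relation.Unary.AllPairs
import Relation.Binary.PropositionalEquality
open import Data.Product using (Σ; ∃; _×_; _,_; proj₁; proj₂)
open import Data.Sum using (_⊎_)
open import Data.Unit using (⊤)
open import Data.Empty using (⊥)
open import Relation.Nullary using (¬_)
open import Relation.Binary.PropositionalEquality using (_≡_; _≢_; refl; trans)

-- Everything is relative to a signature Σ, given by a type Fun of function
-- symbols with an arity map.  Variables X are the natural numbers.
module Theory (Fun : Set) (arity : Fun → ℕ) where

  data Term : Set where
    var : ℕ → Term
    fn  : (f : Fun) → Vec Term (arity f) → Term

  data TermE : Set where
    ε  : TermE
    tm : Term → TermE

  mutual
    data _occ_ (x : ℕ) : Term → Set where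
      here   : x occ var x
      inside : ∀ {f ts} → x occs ts → x occ fn f ts

    data _occs_ (x : ℕ) : ∀ {k} → Vec Term k → Set where
      hd : ∀ {k t} {ts : Vec Term k} → x occ t → x occs (t ∷ ts)
      tl : ∀ {k t} {ts : Vec Term k} → x occs ts → x occs (t ∷ ts)

  VarE : TermE → ℕ → Set
  VarE ε      x = ⊥
  VarE (tm t) x = x occ t

  record Subst : Set where
    field
      app : ℕ → Term
      bnd : ℕ
      fin : ∀ x → bnd ≤ x → app x ≡ var x
  open Subst public

  mutual
    _⟨_⟩ : Term → Subst → Term
    var x    ⟨ θ ⟩ = app θ x
    fn f ts  ⟨ θ ⟩ = fn f (ts ⟨ θ ⟩s)

    _⟨_⟩s : ∀ {k} → Vec Term k → Subst → Vec Term k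
    []       ⟨ θ ⟩s = []
    (t ∷ ts) ⟨ θ ⟩s = (t ⟨ θ ⟩) ∷ (ts ⟨ θ ⟩s)

  _⟨_⟩e : TermE → Subst → TermE
  ε    ⟨ θ ⟩e = ε
  tm t ⟨ θ ⟩e = tm (t ⟨ θ ⟩)

  idS : Subst
  idS = record { app = var ; bnd = 0 ; fin = λ _ _ → refl }

  _⨾_ : Subst → Subst → Subst
  σ ⨾ θ = record
    { app = λ x → app σ x ⟨ θ ⟩
    ; bnd = bnd σ ⊔ bnd θ
    ; fin = λ x h → trans
        (Relation.Binary.PropositionalEquality.cong (_⟨ θ ⟩)
           (fin σ x (≤-trans (m≤m⊔n (bnd σ) (bnd θ)) h)))
        (fin θ x (≤-trans (m≤n⊔m (bnd σ) (bnd θ)) h))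
    }

  _^_ : Subst → ℕ → Subst
  σ ^ zero  = idS
  σ ^ suc n = (σ ^ n) ⨾ σ

  Commute : Subst → Subst → Set
  Commute σ θ = ∀ x → app (σ ⨾ θ) x ≡ app (θ ⨾ σ) x

  VarS : Subst → ℕ → Set
  VarS σ x = (app σ x ≢ var x) ⊎ (∃ λ y → (app σ y ≢ var y) × (x occ app σ y))

  IsRenaming : Subst → Set
  IsRenaming ρ = Σ (ℕ → ℕ) λ f →
      (∀ x → app ρ x ≡ var (f x))
    × (∀ x y → f x ≡ f y → x ≡ y)
    × (∀ y → ∃ λ x → f x ≡ y)

  Unifies : Subst → List Term → List Term → Set
  Unifies θ []       []       = ⊤
  Unifies θ (a ∷ as) (b ∷ bs) = (a ⟨ θ ⟩ ≡ b ⟨ θ ⟩) × Unifies θ as bs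
  Unifies θ _        _        = ⊥

  IsMGU : Subst → List Term → List Term → Set
  IsMGU θ as bs = Unifies θ as bs
    × (∀ η → Unifies η as bs → ∃ λ δ → ∀ x → app η x ≡ app (θ ⨾ δ) x)

  Rule : Set
  Rule = Term × List Term

  VarR : Rule → ℕ → Set
  VarR (u , vs) x = (x occ u) ⊎ Data.List.Relation.Unary.Any.Any (x occ_) vs

  Program : Set₁
  Program = Rule → Set

  BRule : Set
  BRule = Term × TermE

  VarB : BRule → ℕ → Set
  VarB (u , v) x = (x occ u) ⊎ VarE v x

  renB : BRule → Subst → BRule
  renB (u , v) ρ = (u ⟨ ρ ⟩ , v ⟨ ρ ⟩e)

  RenClosB : (BRule → Set) → BRule → Set
  RenClosB U b = ∃ λ b₀ → ∃ λ ρ → U b₀ × IsRenaming ρ × (b ≡ renB b₀ ρ)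

  DistinctVars : ∀ {k} → Vec ℕ k → Set
  DistinctVars xs = Data.Vec.Relation.Unary.AllPairs.AllPairs _≢_ xs

  IdRules : BRule → Set
  IdRules b = ∃ λ f → ∃ λ (xs : Vec ℕ (arity f)) →
    DistinctVars xs × (b ≡ (fn f (V.map var xs) , tm (fn f (V.map var xs))))

  Disjoint : (ℕ → Set) → (ℕ → Set) → Set
  Disjoint A B = ∀ x → A x → B x → ⊥

  SeqFrom : {R : Set} → (R → ℕ → Set) → (ℕ → Set) → (R → Set) → List R → Set
  SeqFrom VarOf S U rs =
    All U rs × All (λ r → Disjoint (VarOf r) S) rs
    × AllPairs (λ r r' → Disjoint (VarOf r) (VarOf r')) rs

  _∪_ : {R : Set} → (R → Set) → (R → Set) → R → Set
  (A ∪ B) r = A r ⊎ B r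

  headB : BRule → Term
  headB = proj₁

  bodyB : BRule → TermE
  bodyB = proj₂

  FactsB : Program → BRule → Set
  FactsB P b = ∃ λ u → P (u , []) × (b ≡ (u , ε))

  StepB : Program → (BRule → Set) → BRule → Set
  StepB P U b = ∃ λ u → ∃ λ vs → P (u , vs) ×
    ∃ λ (pre : List BRule) → ∃ λ (lst : BRule) →
      let i = suc (length pre) in
        (i ≤ length vs)
      × All (λ r → bodyB r ≡ ε) pre
      × SeqFrom VarB (VarR (u , vs)) (U ∪ IdRules) (pre ++ lst ∷ [])
      × (i < length vs → bodyB lst ≢ ε)
      × ∃ λ θ → IsMGU θ (map headB (pre ++ lst ∷ [])) (take i vs)
              × (b ≡ (u ⟨ θ ⟩ , bodyB lst ⟨ θ ⟩e))

  Tβ : Program → (BRule → Set) → BRule → Set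
  Tβ P U = RenClosB (FactsB P) ∪ RenClosB (StepB P U)

  iterTβ : Program → ℕ → BRule → Set
  iterTβ P zero    b = ⊥
  iterTβ P (suc n) b = Tβ P (iterTβ P n) b

  binunf : Program → BRule → Set
  binunf P b = ∃ λ n → iterTβ P n b

  PSubst : Set
  PSubst = Subst × Subst

  inst : PSubst → ℕ → Subst
  inst (σ , μ) n = (σ ^ n) ⨾ μ

  PTerm : Set
  PTerm = Term × PSubst

  PTermE : Set
  PTermE = TermE × PSubst

  instP : PTerm → ℕ → Term
  instP (s , π) n = s ⟨ inst π n ⟩

  instPE : PTermE → ℕ → TermE
  instPE (s , π) n = s ⟨ inst π n ⟩e

  VarP : PTerm → ℕ → Set
  VarP (s , (σ , μ)) x = (x occ s) ⊎ VarS σ x ⊎ VarS μ x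

  VarPE : PTermE → ℕ → Set
  VarPE (s , (σ , μ)) x = VarE s x ⊎ VarS σ x ⊎ VarS μ x

  hat : Term → PTerm
  hat s = (s , (idS , idS))

  -- p is ê = (e, (∅, ∅))  (substitutions compared extensionally)
  IsHatE : PTermE → Set
  IsHatE (s , (σ , μ)) = (s ≡ ε) × (∀ x → app σ x ≡ var x) × (∀ x → app μ x ≡ var x)

  PRule : Set
  PRule = PTerm × PTermE

  VarPR : PRule → ℕ → Set
  VarPR (p , q) x = VarP p x ⊎ VarPE q x

  rulesAt : PRule → ℕ → BRule
  rulesAt (p , q) n = (instP p n , instPE q n)

  Correct : Program → PRule → Set
  Correct P r = ∀ n → binunf P (rulesAt r n)

  CorrectSet : Program → (PRule → Set) → Set
  CorrectSet P U = ∀ r → U r → Correct P r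

  IsPMGU : PSubst → List PTerm → List PTerm → Set
  IsPMGU π ps qs = ∀ n → IsMGU (inst π n) (map (λ p → instP p n) ps) (map (λ q → instP q n) qs)

  -- [r] = {r' | rules(r') ⊆ [rules(r)]},  [U] = ⋃_{r ∈ U} [r]
  RenClosP : (PRule → Set) → PRule → Set
  RenClosP U r' = ∃ λ r → U r ×
    (∀ n → ∃ λ m → ∃ λ ρ → IsRenaming ρ × (rulesAt r' n ≡ renB (rulesAt r m) ρ))

  PatId : PRule → Set
  PatId r = ∃ λ f → ∃ λ (xs : Vec ℕ (arity f)) →
    DistinctVars xs × (r ≡ (hat (fn f (V.map var xs)) , (tm (fn f (V.map var xs)) , (idS , idS))))

  headP : PRule → PTerm
  headP = proj₁

  bodyP : PRule → PTermE
  bodyP = proj₂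

  StepP : Program → (PRule → Set) → PRule → Set
  StepP P U r = ∃ λ u → ∃ λ vs → P (u , vs) ×
    ∃ λ (pre : List PRule) → ∃ λ (lst : PRule) →
      let i = suc (length pre) in
        (i ≤ length vs)
      × All (λ r' → IsHatE (bodyP r')) pre
      × SeqFrom VarPR (VarR (u , vs)) (U ∪ PatId) (pre ++ lst ∷ [])
      × (i < length vs → proj₁ (bodyP lst) ≢ ε)
      × ∃ λ σ → ∃ λ μ →
            IsPMGU (σ , μ) (map headP (pre ++ lst ∷ [])) (map hat (take i vs))
          × Commute σ (proj₁ (proj₂ (bodyP lst)))          -- σ commutes with σ_i
          × Commute σ (proj₂ (proj₂ (bodyP lst)))          -- σ commutes with μ_i
          × (r ≡ ((u , (σ , μ)) ,
                  (proj₁ (bodyP lst) ,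
                   (proj₁ (proj₂ (bodyP lst)) ⨾ σ , proj₂ (proj₂ (bodyP lst)) ⨾ μ))))

  Tπ : Program → (PRule → Set) → (PRule → Set) → PRule → Set
  Tπ P B U = RenClosP B ∪ RenClosP (StepP P U)

-- The n-th instance of a pattern rule produced by T^π is produced by T^β from
-- the n-th instances of its premises.  A pattern mgu is, by definition, an mgu
-- at every instance, and since σ commutes with σ_i and μ_i,
--   (σ_i σ)^n (μ_i μ) = (σ_i^n μ_i)(σ^n μ),
-- so the n-th instance of the new body is the premise's n-th body instantiated
-- by the n-th mgu.  The premises' instances lie in finitely many levels of
-- binunf(P), which are nested and closed under renaming.
module Submission where

open import Defs
open import Data.Nat using (ℕ; zero; suc; _≤_; _<_; _⊔_; s≤s; _≟_)
open import Data.Nat.Properties using (m≤m⊔n; m≤n⊔m)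
open import Data.Sum using (_⊎_; inj₁; inj₂; [_,_])
import Data.Sum as Sum
open import Data.Product using (∃; _,_)
open import Data.Vec using (Vec; []; _∷_)
open import Data.List using (List; []; _∷_; _++_; map; take; length)
open import Data.List.Properties using (map-∘; map-cong; map-id; map-++; length-map)
open import Data.List.Relation.Unary.All using (All; []; _∷_)
import Data.List.Relation.Unary.All as All
import Data.List.Relation.Unary.All.Properties as All
import Data.List.Relation.Unary.AllPairs as AllPairs
import Data.List.Relation.Unary.AllPairs.Properties as AllPairs
open import Data.Empty using (⊥; ⊥-elim)
open import Function using (_∘_)
open import Relation.Nullary using (Dec; yes; no)
open import Relation.Nullary.Decidable using (map′)
open import Relation.Unary using (_⊆_)
open import Relation.Binary using (Setoid)
open import Relation.Binary.PropositionalEquality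
  using (_≡_; _≢_; refl; sym; trans; cong; cong₂; subst; subst₂)

module _ (Fun : Set) (arity : Fun → ℕ) where
  open Theory Fun arity

  -- A record rather than a bare ∀, so that σ and θ can be inferred from σ ≈ θ.
  infix 4 _≈_
  record _≈_ (σ θ : Subst) : Set where
    constructor pointwise
    field agree : ∀ x → app σ x ≡ app θ x
  open _≈_

  ≈-setoid : Setoid _ _
  ≈-setoid = record
    { Carrier       = Subst
    ; _≈_           = _≈_
    ; isEquivalence = record
      { refl  = pointwise λ _ → refl
      ; sym   = λ σ≈θ → pointwise λ x → sym (agree σ≈θ x)
      ; trans = λ σ≈θ θ≈η → pointwise λ x → trans (agree σ≈θ x) (agree θ≈η x)
      }
    }

  open Setoid ≈-setoid using () renaming (refl to ≈-refl; trans to ≈-trans)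

  mutual
    ⟨⟩-cong : ∀ {σ θ} → σ ≈ θ → ∀ t → t ⟨ σ ⟩ ≡ t ⟨ θ ⟩
    ⟨⟩-cong σ≈θ (var x)   = agree σ≈θ x
    ⟨⟩-cong σ≈θ (fn f ts) = cong (fn f) (⟨⟩s-cong σ≈θ ts)

    ⟨⟩s-cong : ∀ {σ θ} → σ ≈ θ → ∀ {k} (ts : Vec Term k) → ts ⟨ σ ⟩s ≡ ts ⟨ θ ⟩s
    ⟨⟩s-cong σ≈θ []       = refl
    ⟨⟩s-cong σ≈θ (t ∷ ts) = cong₂ _∷_ (⟨⟩-cong σ≈θ t) (⟨⟩s-cong σ≈θ ts)

  mutual
    ⟨⟩-⨾ : ∀ σ θ t → t ⟨ σ ⟩ ⟨ θ ⟩ ≡ t ⟨ σ ⨾ θ ⟩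
    ⟨⟩-⨾ σ θ (var x)   = refl
    ⟨⟩-⨾ σ θ (fn f ts) = cong (fn f) (⟨⟩s-⨾ σ θ ts)

    ⟨⟩s-⨾ : ∀ σ θ {k} (ts : Vec Term k) → ts ⟨ σ ⟩s ⟨ θ ⟩s ≡ ts ⟨ σ ⨾ θ ⟩s
    ⟨⟩s-⨾ σ θ []       = refl
    ⟨⟩s-⨾ σ θ (t ∷ ts) = cong₂ _∷_ (⟨⟩-⨾ σ θ t) (⟨⟩s-⨾ σ θ ts)

  mutual
    ⟨⟩-idS : ∀ t → t ⟨ idS ⟩ ≡ t
    ⟨⟩-idS (var x)   = refl
    ⟨⟩-idS (fn f ts) = cong (fn f) (⟨⟩s-idS ts)

    ⟨⟩s-idS : ∀ {k} (ts : Vec Term k) → ts ⟨ idS ⟩s ≡ ts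
    ⟨⟩s-idS []       = refl
    ⟨⟩s-idS (t ∷ ts) = cong₂ _∷_ (⟨⟩-idS t) (⟨⟩s-idS ts)

  ⟨⟩e-cong : ∀ {σ θ} → σ ≈ θ → ∀ v → v ⟨ σ ⟩e ≡ v ⟨ θ ⟩e
  ⟨⟩e-cong σ≈θ ε      = refl
  ⟨⟩e-cong σ≈θ (tm t) = cong tm (⟨⟩-cong σ≈θ t)

  ⟨⟩e-⨾ : ∀ σ θ v → v ⟨ σ ⟩e ⟨ θ ⟩e ≡ v ⟨ σ ⨾ θ ⟩e
  ⟨⟩e-⨾ σ θ ε      = refl
  ⟨⟩e-⨾ σ θ (tm t) = cong tm (⟨⟩-⨾ σ θ t)

  ⟨⟩e-idS : ∀ v → v ⟨ idS ⟩e ≡ v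
  ⟨⟩e-idS ε      = refl
  ⟨⟩e-idS (tm t) = cong tm (⟨⟩-idS t)

  ⟨⟩e-≢ε : ∀ {v} θ → v ≢ ε → v ⟨ θ ⟩e ≢ ε
  ⟨⟩e-≢ε {ε}    θ v≢ε = ⊥-elim (v≢ε refl)
  ⟨⟩e-≢ε {tm t} θ _   = λ ()

  ⨾-assoc : ∀ σ θ η → (σ ⨾ θ) ⨾ η ≈ σ ⨾ (θ ⨾ η)
  ⨾-assoc σ θ η = pointwise λ x → ⟨⟩-⨾ θ η (app σ x)

  ⨾-cong : ∀ {σ σ′ θ θ′} → σ ≈ σ′ → θ ≈ θ′ → σ ⨾ θ ≈ σ′ ⨾ θ′
  ⨾-cong {σ′ = σ′} {θ = θ} σ≈σ′ θ≈θ′ =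
    pointwise λ x → trans (cong (_⟨ θ ⟩) (agree σ≈σ′ x)) (⟨⟩-cong θ≈θ′ (app σ′ x))

  ⨾-identityʳ : ∀ σ → σ ⨾ idS ≈ σ
  ⨾-identityʳ σ = pointwise λ x → ⟨⟩-idS (app σ x)

  idS^n≈idS : ∀ n → idS ^ n ≈ idS
  idS^n≈idS zero    = ≈-refl
  idS^n≈idS (suc n) = ≈-trans (⨾-identityʳ (idS ^ n)) (idS^n≈idS n)

  open import Relation.Binary.Reasoning.Setoid ≈-setoid

  ^-commute : ∀ σ θ → σ ⨾ θ ≈ θ ⨾ σ → ∀ n → (σ ^ n) ⨾ θ ≈ θ ⨾ (σ ^ n)
  ^-commute σ θ comm zero    = pointwise λ x → sym (⟨⟩-idS (app θ x))
  ^-commute σ θ comm (suc n) = begin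
    ((σ ^ n) ⨾ σ) ⨾ θ   ≈⟨ ⨾-assoc (σ ^ n) σ θ ⟩
    (σ ^ n) ⨾ (σ ⨾ θ)   ≈⟨ ⨾-cong (≈-refl {σ ^ n}) comm ⟩
    (σ ^ n) ⨾ (θ ⨾ σ)   ≈⟨ ⨾-assoc (σ ^ n) θ σ ⟨
    ((σ ^ n) ⨾ θ) ⨾ σ   ≈⟨ ⨾-cong (^-commute σ θ comm n) (≈-refl {σ}) ⟩
    (θ ⨾ (σ ^ n)) ⨾ σ   ≈⟨ ⨾-assoc θ (σ ^ n) σ ⟩
    θ ⨾ ((σ ^ n) ⨾ σ)   ∎

  ^-distrib-⨾ : ∀ σ θ → σ ⨾ θ ≈ θ ⨾ σ → ∀ n → (θ ⨾ σ) ^ n ≈ (θ ^ n) ⨾ (σ ^ n)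
  ^-distrib-⨾ σ θ comm zero    = ≈-refl
  ^-distrib-⨾ σ θ comm (suc n) = begin
    ((θ ⨾ σ) ^ n) ⨾ (θ ⨾ σ)          ≈⟨ ⨾-cong (^-distrib-⨾ σ θ comm n) (≈-refl {θ ⨾ σ}) ⟩
    ((θ ^ n) ⨾ (σ ^ n)) ⨾ (θ ⨾ σ)    ≈⟨ ⨾-assoc (θ ^ n) (σ ^ n) (θ ⨾ σ) ⟩
    (θ ^ n) ⨾ ((σ ^ n) ⨾ (θ ⨾ σ))    ≈⟨ ⨾-cong (≈-refl {θ ^ n}) (⨾-assoc (σ ^ n) θ σ) ⟨
    (θ ^ n) ⨾ (((σ ^ n) ⨾ θ) ⨾ σ)    ≈⟨ ⨾-cong (≈-refl {θ ^ n}) (⨾-cong (^-commute σ θ comm n) (≈-refl {σ})) ⟩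
    (θ ^ n) ⨾ ((θ ⨾ (σ ^ n)) ⨾ σ)    ≈⟨ ⨾-cong (≈-refl {θ ^ n}) (⨾-assoc θ (σ ^ n) σ) ⟩
    (θ ^ n) ⨾ (θ ⨾ ((σ ^ n) ⨾ σ))    ≈⟨ ⨾-assoc (θ ^ n) θ ((σ ^ n) ⨾ σ) ⟨
    ((θ ^ n) ⨾ θ) ⨾ ((σ ^ n) ⨾ σ)    ∎

  inst-⨾ : ∀ σ μ σ′ μ′ → Commute σ σ′ → Commute σ μ′ →
           ∀ n → inst (σ′ ⨾ σ , μ′ ⨾ μ) n ≈ inst (σ′ , μ′) n ⨾ inst (σ , μ) n
  inst-⨾ σ μ σ′ μ′ σσ′ σμ′ n = begin
    ((σ′ ⨾ σ) ^ n) ⨾ (μ′ ⨾ μ)            ≈⟨ ⨾-cong (^-distrib-⨾ σ σ′ (pointwise σσ′) n) (≈-refl {μ′ ⨾ μ}) ⟩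
    ((σ′ ^ n) ⨾ (σ ^ n)) ⨾ (μ′ ⨾ μ)      ≈⟨ ⨾-assoc (σ′ ^ n) (σ ^ n) (μ′ ⨾ μ) ⟩
    (σ′ ^ n) ⨾ ((σ ^ n) ⨾ (μ′ ⨾ μ))      ≈⟨ ⨾-cong (≈-refl {σ′ ^ n}) (⨾-assoc (σ ^ n) μ′ μ) ⟨
    (σ′ ^ n) ⨾ (((σ ^ n) ⨾ μ′) ⨾ μ)      ≈⟨ ⨾-cong (≈-refl {σ′ ^ n}) (⨾-cong (^-commute σ μ′ (pointwise σμ′) n) (≈-refl {μ})) ⟩
    (σ′ ^ n) ⨾ ((μ′ ⨾ (σ ^ n)) ⨾ μ)      ≈⟨ ⨾-cong (≈-refl {σ′ ^ n}) (⨾-assoc μ′ (σ ^ n) μ) ⟩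
    (σ′ ^ n) ⨾ (μ′ ⨾ ((σ ^ n) ⨾ μ))      ≈⟨ ⨾-assoc (σ′ ^ n) μ′ ((σ ^ n) ⨾ μ) ⟨
    ((σ′ ^ n) ⨾ μ′) ⨾ ((σ ^ n) ⨾ μ)      ∎

  instP-hat : ∀ n t → instP (hat t) n ≡ t
  instP-hat n t = trans (⟨⟩-cong (⨾-identityʳ (idS ^ n)) t)
                        (trans (⟨⟩-cong (idS^n≈idS n) t) (⟨⟩-idS t))

  var-injective : ∀ {x y} → var x ≡ var y → x ≡ y
  var-injective refl = refl

  _≟var_ : ∀ t y → Dec (t ≡ var y)
  var x   ≟var y = map′ (cong var) var-injective (x ≟ y)
  fn f ts ≟var y = no λ ()

  occ-var : ∀ {x y} → x occ var y → x ≡ y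
  occ-var here = refl

  occ-app : ∀ θ y {x} → x occ app θ y → x ≡ y ⊎ VarS θ x
  occ-app θ y x∈θy with app θ y ≟var y
  ... | yes θy≡y = inj₁ (occ-var (subst (_ occ_) θy≡y x∈θy))
  ... | no  θy≢y = inj₂ (inj₂ (y , θy≢y , x∈θy))

  mutual
    occ-⟨⟩ : ∀ θ t {x} → x occ (t ⟨ θ ⟩) → x occ t ⊎ VarS θ x
    occ-⟨⟩ θ (var y) x∈θy with occ-app θ y x∈θy
    ... | inj₁ refl  = inj₁ here
    ... | inj₂ x∈θ   = inj₂ x∈θ
    occ-⟨⟩ θ (fn f ts) (inside x∈ts) = Sum.map₁ inside (occs-⟨⟩s θ ts x∈ts)

    occs-⟨⟩s : ∀ θ {k} (ts : Vec Term k) {x} → x occs (ts ⟨ θ ⟩s) → x occs ts ⊎ VarS θ x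
    occs-⟨⟩s θ (t ∷ ts) (hd x∈t)  = Sum.map₁ hd (occ-⟨⟩ θ t x∈t)
    occs-⟨⟩s θ (t ∷ ts) (tl x∈ts) = Sum.map₁ tl (occs-⟨⟩s θ ts x∈ts)

  VarS-⨾ : ∀ σ θ {x} → VarS (σ ⨾ θ) x → VarS σ x ⊎ VarS θ x
  VarS-⨾ σ θ {x} (inj₁ σθx≢x) with app σ x ≟var x
  ... | yes σx≡x = inj₂ (inj₁ λ θx≡x → σθx≢x (trans (cong (_⟨ θ ⟩) σx≡x) θx≡x))
  ... | no  σx≢x = inj₁ (inj₁ σx≢x)
  VarS-⨾ σ θ {x} (inj₂ (y , σθy≢y , x∈σθy)) with occ-⟨⟩ θ (app σ y) x∈σθy
  ... | inj₂ x∈θ = inj₂ x∈θ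
  ... | inj₁ x∈σy with app σ y ≟var y
  ...   | no  σy≢y = inj₁ (inj₂ (y , σy≢y , x∈σy))
  ...   | yes σy≡y with occ-var (subst (x occ_) σy≡y x∈σy)
  ...     | refl = inj₂ (inj₁ λ θx≡x → σθy≢y (trans (cong (_⟨ θ ⟩) σy≡y) θx≡x))

  VarS-idS : ∀ {x} → VarS idS x → ⊥
  VarS-idS (inj₁ x≢x)           = x≢x refl
  VarS-idS (inj₂ (y , y≢y , _)) = y≢y refl

  VarS-^ : ∀ σ n {x} → VarS (σ ^ n) x → VarS σ x
  VarS-^ σ zero    x∈ = ⊥-elim (VarS-idS x∈)
  VarS-^ σ (suc n) x∈ = Sum.fromInj₂ (VarS-^ σ n) (VarS-⨾ (σ ^ n) σ x∈)

  VarS-inst : ∀ σ μ n {x} → VarS (inst (σ , μ) n) x → VarS σ x ⊎ VarS μ x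
  VarS-inst σ μ n x∈ = Sum.map₁ (VarS-^ σ n) (VarS-⨾ (σ ^ n) μ x∈)

  VarB-rulesAt : ∀ r n {x} → VarB (rulesAt r n) x → VarPR r x
  VarB-rulesAt ((s , (σ , μ)) , _) n (inj₁ x∈) with occ-⟨⟩ (inst (σ , μ) n) s x∈
  ... | inj₁ x∈s = inj₁ (inj₁ x∈s)
  ... | inj₂ x∈θ = inj₁ (inj₂ (VarS-inst σ μ n x∈θ))
  VarB-rulesAt (_ , (tm t , (σ , μ))) n (inj₂ x∈) with occ-⟨⟩ (inst (σ , μ) n) t x∈
  ... | inj₁ x∈t = inj₂ (inj₁ x∈t)
  ... | inj₂ x∈θ = inj₂ (inj₂ (VarS-inst σ μ n x∈θ))

  IsRenaming-idS : IsRenaming idS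
  IsRenaming-idS = (λ x → x) , (λ _ → refl) , (λ _ _ eq → eq) , (λ y → y , refl)

  IsRenaming-⨾ : ∀ {ρ ρ′} → IsRenaming ρ → IsRenaming ρ′ → IsRenaming (ρ ⨾ ρ′)
  IsRenaming-⨾ {ρ′ = ρ′} (f , ρ≡f , f-inj , f-surj) (g , ρ′≡g , g-inj , g-surj) =
    (λ x → g (f x)) ,
    (λ x → trans (cong (_⟨ ρ′ ⟩) (ρ≡f x)) (ρ′≡g (f x))) ,
    (λ x y eq → f-inj x y (g-inj (f x) (f y) eq)) ,
    (λ z → let (y , gy≡z) = g-surj z ; (x , fx≡y) = f-surj y in x , trans (cong g fx≡y) gy≡z)

  renB-⨾ : ∀ b ρ ρ′ → renB (renB b ρ) ρ′ ≡ renB b (ρ ⨾ ρ′)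
  renB-⨾ (u , v) ρ ρ′ = cong₂ _,_ (⟨⟩-⨾ ρ ρ′ u) (⟨⟩e-⨾ ρ ρ′ v)

  renB-idS : ∀ b → renB b idS ≡ b
  renB-idS (u , v) = cong₂ _,_ (⟨⟩-idS u) (⟨⟩e-idS v)

  RenClosB-renB : ∀ {X : BRule → Set} {b ρ} → RenClosB X b → IsRenaming ρ → RenClosB X (renB b ρ)
  RenClosB-renB {ρ = ρ} (b₀ , ρ₀ , b₀∈X , ρ₀-ren , refl) ρ-ren =
    b₀ , ρ₀ ⨾ ρ , b₀∈X , IsRenaming-⨾ {ρ₀} {ρ} ρ₀-ren ρ-ren , renB-⨾ b₀ ρ₀ ρ

  RenClosB-self : ∀ {X : BRule → Set} → X ⊆ RenClosB X
  RenClosB-self {x = b} b∈X = b , idS , b∈X , IsRenaming-idS , sym (renB-idS b)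

  RenClosB-mono : ∀ {X Y : BRule → Set} → X ⊆ Y → RenClosB X ⊆ RenClosB Y
  RenClosB-mono X⊆Y (b₀ , ρ , b₀∈X , ρ-ren , eq) = b₀ , ρ , X⊆Y b₀∈X , ρ-ren , eq

  iterTβ-renB : ∀ P n {b ρ} → iterTβ P n b → IsRenaming ρ → iterTβ P n (renB b ρ)
  iterTβ-renB P (suc n) (inj₁ b∈) ρ-ren = inj₁ (RenClosB-renB b∈ ρ-ren)
  iterTβ-renB P (suc n) (inj₂ b∈) ρ-ren = inj₂ (RenClosB-renB b∈ ρ-ren)

  StepB-mono : ∀ P {U V : BRule → Set} → U ⊆ V → StepB P U ⊆ StepB P V
  StepB-mono P U⊆V (u , vs , r∈P , pre , lst , i≤m , pre-ε , (∈U , disj , pairwise) , rest) =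
    u , vs , r∈P , pre , lst , i≤m , pre-ε , (All.map (Sum.map₁ U⊆V) ∈U , disj , pairwise) , rest

  Tβ-mono : ∀ P {U V : BRule → Set} → U ⊆ V → Tβ P U ⊆ Tβ P V
  Tβ-mono P U⊆V = Sum.map₂ (RenClosB-mono (StepB-mono P U⊆V))

  iterTβ-mono : ∀ P {m n} → m ≤ n → iterTβ P m ⊆ iterTβ P n
  iterTβ-mono P {suc m} {suc n} (s≤s m≤n) = Tβ-mono P (iterTβ-mono P m≤n)

  common-level : ∀ P (bs : List BRule) → All (binunf P ∪ IdRules) bs →
                 ∃ λ K → All (iterTβ P K ∪ IdRules) bs
  common-level P []       []       = 0 , []
  common-level P (b ∷ bs) (b∈ ∷ bs∈) with common-level P bs bs∈
  ... | K , bs∈K with b∈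
  ...   | inj₂ b∈id      = K , inj₂ b∈id ∷ bs∈K
  ...   | inj₁ (k , b∈k) = k ⊔ K ,
          inj₁ (iterTβ-mono P (m≤m⊔n k K) b∈k) ∷ All.map (Sum.map₁ (iterTβ-mono P (m≤n⊔m k K))) bs∈K

  RenClosP-correct : ∀ P {U : PRule → Set} → CorrectSet P U → CorrectSet P (RenClosP U)
  RenClosP-correct P U-correct r (r₀ , r₀∈U , renamed) n with renamed n
  ... | m , ρ , ρ-ren , eq with U-correct r₀ r₀∈U m
  ...   | k , r₀m∈k = k , subst (iterTβ P k) (sym eq) (iterTβ-renB P k r₀m∈k ρ-ren)

  rulesAt-PatId : ∀ r n → PatId r → IdRules (rulesAt r n)
  rulesAt-PatId r n (f , xs , distinct , refl) =
    f , xs , distinct , cong₂ _,_ (instP-hat n t) (cong tm (instP-hat n t))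
    where t = fn f (Data.Vec.map var xs)

  rulesAt-IsHatE : ∀ r n → IsHatE (bodyP r) → bodyB (rulesAt r n) ≡ ε
  rulesAt-IsHatE (_ , (ε , _)) n _ = refl

  SeqFrom-rulesAt : ∀ P {U : PRule → Set} → CorrectSet P U → ∀ S n (rs : List PRule) →
    SeqFrom VarPR S (U ∪ PatId) rs →
    ∃ λ K → SeqFrom VarB S (iterTβ P K ∪ IdRules) (map (λ r → rulesAt r n) rs)
  SeqFrom-rulesAt P {U} U-correct S n rs (∈U , disj , pairwise)
    with common-level P _ (All.map⁺ (All.map instance-∈ ∈U))
    where
    instance-∈ : ∀ {r} → (U ∪ PatId) r → (binunf P ∪ IdRules) (rulesAt r n)
    instance-∈ {r} = Sum.map (λ r∈U → U-correct r r∈U n) (rulesAt-PatId r n)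
  ... | K , ∈K =
    K , ∈K ,
    All.map⁺ (All.map (λ {r} d x x∈ → d x (VarB-rulesAt r n x∈)) disj) ,
    AllPairs.map⁺ (AllPairs.map (λ {r r′} d x x∈ x∈′ → d x (VarB-rulesAt r n x∈) (VarB-rulesAt r′ n x∈′)) pairwise)

  map-instP-hat : ∀ n (ts : List Term) → map (λ q → instP q n) (map hat ts) ≡ ts
  map-instP-hat n ts = trans (sym (map-∘ ts)) (trans (map-cong (instP-hat n) ts) (map-id ts))

  StepP-correct : ∀ P {U : PRule → Set} → CorrectSet P U → CorrectSet P (StepP P U)
  StepP-correct P {U} U-correct ._
    (u , vs , r∈P , pre , lst@(_ , (v , (σ′ , μ′))) , i≤m , pre-ê , seq , v≢ε ,
     σ , μ , pmgu , σσ′ , σμ′ , refl) n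
    with SeqFrom-rulesAt P U-correct (VarR (u , vs)) n (pre ++ lst ∷ []) seq
  ... | K , seqₙ = suc K , inj₂ (RenClosB-self
        (u , vs , r∈P , preₙ , lstₙ , i≤m′ , pre-εₙ , seqₙ′ , v≢εₙ , θ , mguₙ , bodyₙ))
    where
    instₙ : PRule → BRule
    instₙ r = rulesAt r n
    preₙ : List BRule
    preₙ = map instₙ pre
    lstₙ : BRule
    lstₙ = instₙ lst
    θ : Subst
    θ = inst (σ , μ) n
    |preₙ|≡|pre| : length preₙ ≡ length pre
    |preₙ|≡|pre| = length-map instₙ pre
    map-instₙ : map instₙ (pre ++ lst ∷ []) ≡ preₙ ++ lstₙ ∷ []
    map-instₙ = map-++ instₙ pre (lst ∷ [])
    i≤m′ : suc (length preₙ) ≤ length vs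
    i≤m′ = subst (λ k → suc k ≤ length vs) (sym |preₙ|≡|pre|) i≤m
    pre-εₙ : All (λ b → bodyB b ≡ ε) preₙ
    pre-εₙ = All.map⁺ (All.map (λ {r} → rulesAt-IsHatE r n) pre-ê)
    seqₙ′ : SeqFrom VarB (VarR (u , vs)) (iterTβ P K ∪ IdRules) (preₙ ++ lstₙ ∷ [])
    seqₙ′ = subst (SeqFrom VarB (VarR (u , vs)) (iterTβ P K ∪ IdRules)) map-instₙ seqₙ
    v≢εₙ : suc (length preₙ) < length vs → bodyB lstₙ ≢ ε
    v≢εₙ i<m = ⟨⟩e-≢ε (inst (σ′ , μ′) n) (v≢ε (subst (λ k → suc k < length vs) |preₙ|≡|pre| i<m))
    mguₙ : IsMGU θ (map headB (preₙ ++ lstₙ ∷ [])) (take (suc (length preₙ)) vs)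
    heads : ∀ rs → map (λ p → instP p n) (map headP rs) ≡ map headB (map instₙ rs)
    heads rs = trans (sym (map-∘ rs)) (map-∘ rs)
    mguₙ = subst₂ (IsMGU θ)
      (trans (heads (pre ++ lst ∷ [])) (cong (map headB) map-instₙ))
      (trans (map-instP-hat n _) (cong (λ k → take (suc k) vs) (sym |preₙ|≡|pre|)))
      (pmgu n)
    bodyₙ : rulesAt ((u , (σ , μ)) , (v , (σ′ ⨾ σ , μ′ ⨾ μ))) n ≡ (u ⟨ θ ⟩ , bodyB lstₙ ⟨ θ ⟩e)
    bodyₙ = cong (u ⟨ θ ⟩ ,_)
      (trans (⟨⟩e-cong (inst-⨾ σ μ σ′ μ′ σσ′ σμ′ n) v) (sym (⟨⟩e-⨾ (inst (σ′ , μ′) n) θ v)))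

propositionA2 : (Fun : Set) (arity : Fun → ℕ) →
    let open Theory Fun arity in
    (P : Program) (B U : PRule → Set) →
    CorrectSet P (λ r → B r ⊎ U r) →
    CorrectSet P (Tπ P B U)
propositionA2 Fun arity P B U B∪U-correct r =
  [ RenClosP-correct Fun arity P (λ r′ → B∪U-correct r′ ∘ inj₁) r
  , RenClosP-correct Fun arity P (StepP-correct Fun arity P (λ r′ → B∪U-correct r′ ∘ inj₂)) r
  ]
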